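{- Let $S_1,S_2$ be sets of Wang prototiles which share no common edge meets. If $S_1$ and $S_2$ are both periodic, then $S_1\cup S_2$ is periodic; if $S_1$ and $S_2$ are both aperiodic, then $S_1\cup S_2$ is aperiodic.
   Context: A Wang prototile is a 4-tuple $\langle l,u,r,b\rangle$ of colours for left, upper, right, bottom quarters of a diagonally quadrisected square. A tiling of the plane by a set $S$ is a map $T:\mathbb{Z}^2\to S$ with right colour of $T(x,y)$ = left colour of $T(x+1,y)$ and upper colour of $T(x,y)$ = bottom colour of $T(x,y+1)$ for all $(x,y)$ (no rotations). A tiling $T$ is periodic if there is a nonzero $\mathbf v\in\mathbb{Z}^2$ with $T(p+\mathbf v)=T(p)$ for all $p$, aperiodic otherwise. A set of prototiles is periodic if it admits only periodic tilings of the plane, and aperiodic if it admits no periodic tilings of the plane. $S_1$ and $S_2$ have a common edge meet if there are $t=\langle l,u,r,b\rangle\in S_1$ and $s\in S_2$ such that the left colour of $s$ equals $r$, or the upper colour of $s$ equals $b$, or the right colour of $s$ equals $l$, or the bottom colour of $s$ equals $u$. -}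

module Defs where

open import Level using (Level; _⊔_; suc)
open import Data.Integer using (ℤ; _+_; 0ℤ; 1ℤ)
open import Data.Product using (_×_; _,_; Σ; ∃; proj₁; proj₂)
open import Data.Sum using (_⊎_)
open import Relation.Binary.PropositionalEquality using (_≡_)
open import Relation.Nullary using (¬_)

record Prototile (C : Set) : Set where
  constructor ⟨_,_,_,_⟩
  field
    left  : C
    upper : C
    right : C
    bottom : C
open Prototile public

PSet : (C : Set) → Set₁
PSet C = Prototile C → Set

_∪_ : {C : Set} → PSet C → PSet C → PSet C
(S₁ ∪ S₂) t = S₁ t ⊎ S₂ t

IsTiling : {C : Set} → PSet C → (ℤ × ℤ → Prototile C) → Set
IsTiling S T =
  (∀ p → S (T p)) ×
  (∀ x y → right (T (x , y)) ≡ left (T (x + 1ℤ , y))) ×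
  (∀ x y → upper (T (x , y)) ≡ bottom (T (x , y + 1ℤ)))

_+²_ : ℤ × ℤ → ℤ × ℤ → ℤ × ℤ
(a , b) +² (c , d) = (a + c , b + d)

IsPeriodicTiling : {C : Set} → (ℤ × ℤ → Prototile C) → Set
IsPeriodicTiling T =
  Σ (ℤ × ℤ) λ v → ¬ (v ≡ (0ℤ , 0ℤ)) × (∀ p → T (p +² v) ≡ T p)

PeriodicSet : {C : Set} → PSet C → Set
PeriodicSet S = ∀ T → IsTiling S T → IsPeriodicTiling T

AperiodicSet : {C : Set} → PSet C → Set
AperiodicSet S = ∀ T → IsTiling S T → ¬ IsPeriodicTiling T

CommonEdgeMeet : {C : Set} → PSet C → PSet C → Set
CommonEdgeMeet S₁ S₂ =
  Σ _ λ t → Σ _ λ s → S₁ t × S₂ s ×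
    ((left s ≡ right t) ⊎ (upper s ≡ bottom t) ⊎
     (right s ≡ left t) ⊎ (bottom s ≡ upper t))

{-# OPTIONS --safe #-}
-- Without common edge meets, two edge-adjacent tiles of a tiling by S₁ ∪ S₂
-- lie in the same Sᵢ.  Since ℤ² is connected through edge-adjacency, every
-- tiling by S₁ ∪ S₂ is a tiling by S₁ alone or by S₂ alone, and both
-- periodicity and aperiodicity pass to the union.
module Submission where

open import Defs
open import Data.Product using (_×_; _,_; proj₁; proj₂)
open import Data.Sum using (_⊎_; inj₁; inj₂; [_,_]; swap)
open import Data.Nat using (zero; suc)
import Data.Nat.Properties as ℕ
open import Data.Empty using (⊥; ⊥-elim)
open import Data.Integer using (ℤ; +_; -[1+_]; 0ℤ; 1ℤ) renaming (_+_ to _+ℤ_)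
open import Relation.Binary.PropositionalEquality using (sym; cong; subst)
open import Relation.Nullary using (¬_)

¬CommonEdgeMeet-sym : {C : Set} {S₁ S₂ : PSet C} →
  ¬ CommonEdgeMeet S₁ S₂ → ¬ CommonEdgeMeet S₂ S₁
¬CommonEdgeMeet-sym ne (t , s , t∈ , s∈ , inj₁ e) =
  ne (s , t , s∈ , t∈ , inj₂ (inj₂ (inj₁ (sym e))))
¬CommonEdgeMeet-sym ne (t , s , t∈ , s∈ , inj₂ (inj₁ e)) =
  ne (s , t , s∈ , t∈ , inj₂ (inj₂ (inj₂ (sym e))))
¬CommonEdgeMeet-sym ne (t , s , t∈ , s∈ , inj₂ (inj₂ (inj₁ e))) =
  ne (s , t , s∈ , t∈ , inj₁ (sym e))
¬CommonEdgeMeet-sym ne (t , s , t∈ , s∈ , inj₂ (inj₂ (inj₂ e))) =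
  ne (s , t , s∈ , t∈ , inj₂ (inj₁ (sym e)))

IsTiling-∪-comm : {C : Set} {S₁ S₂ : PSet C} {T : ℤ × ℤ → Prototile C} →
  IsTiling (S₁ ∪ S₂) T → IsTiling (S₂ ∪ S₁) T
IsTiling-∪-comm (covers , horizontal , vertical) =
  (λ p → swap (covers p)) , horizontal , vertical

ℤ-induction : (P : ℤ → Set) → (∀ i → P i → P (i +ℤ 1ℤ)) →
  (∀ i → P (i +ℤ 1ℤ) → P i) → P 0ℤ → ∀ i → P i
ℤ-induction P up down p₀ (+ zero) = p₀
ℤ-induction P up down p₀ (+ suc n) =
  subst P (cong +_ (ℕ.+-comm n 1)) (up (+ n) (ℤ-induction P up down p₀ (+ n)))
ℤ-induction P up down p₀ -[1+ zero ] = down -[1+ zero ] p₀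
ℤ-induction P up down p₀ -[1+ suc n ] =
  down -[1+ suc n ] (ℤ-induction P up down p₀ -[1+ n ])

module _ {C : Set} {A B : PSet C} (ne : ¬ CommonEdgeMeet A B)
         {T : ℤ × ℤ → Prototile C} (tiling : IsTiling (A ∪ B) T) where

  private
    covers = proj₁ tiling
    horizontal = proj₁ (proj₂ tiling)
    vertical = proj₂ (proj₂ tiling)

    in-A : ∀ p → (B (T p) → ⊥) → A (T p)
    in-A p not-B = [ (λ a → a) , (λ b → ⊥-elim (not-B b)) ] (covers p)

  right-neighbour-in-A : ∀ x y → A (T (x , y)) → A (T (x +ℤ 1ℤ , y))
  right-neighbour-in-A x y a = in-A _ λ b →
    ne (_ , _ , a , b , inj₁ (sym (horizontal x y)))

  left-neighbour-in-A : ∀ x y → A (T (x +ℤ 1ℤ , y)) → A (T (x , y))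
  left-neighbour-in-A x y a = in-A _ λ b →
    ne (_ , _ , a , b , inj₂ (inj₂ (inj₁ (horizontal x y))))

  upper-neighbour-in-A : ∀ x y → A (T (x , y)) → A (T (x , y +ℤ 1ℤ))
  upper-neighbour-in-A x y a = in-A _ λ b →
    ne (_ , _ , a , b , inj₂ (inj₂ (inj₂ (sym (vertical x y)))))

  lower-neighbour-in-A : ∀ x y → A (T (x , y +ℤ 1ℤ)) → A (T (x , y))
  lower-neighbour-in-A x y a = in-A _ λ b →
    ne (_ , _ , a , b , inj₂ (inj₁ (vertical x y)))

  IsTiling-restrict : A (T (0ℤ , 0ℤ)) → IsTiling A T
  IsTiling-restrict a₀ = everywhere-in-A , horizontal , vertical
    where
    row-in-A : ∀ x → A (T (x , 0ℤ))
    row-in-A = ℤ-induction (λ x → A (T (x , 0ℤ)))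
      (λ x → right-neighbour-in-A x 0ℤ) (λ x → left-neighbour-in-A x 0ℤ) a₀

    everywhere-in-A : ∀ p → A (T p)
    everywhere-in-A (x , y) = ℤ-induction (λ y → A (T (x , y)))
      (upper-neighbour-in-A x) (lower-neighbour-in-A x) (row-in-A x) y

IsTiling-∪-split : {C : Set} {S₁ S₂ : PSet C} {T : ℤ × ℤ → Prototile C} →
  ¬ CommonEdgeMeet S₁ S₂ → IsTiling (S₁ ∪ S₂) T → IsTiling S₁ T ⊎ IsTiling S₂ T
IsTiling-∪-split {S₁ = S₁} {S₂} ne tiling with proj₁ tiling (0ℤ , 0ℤ)
... | inj₁ t₀∈S₁ = inj₁ (IsTiling-restrict ne tiling t₀∈S₁)
... | inj₂ t₀∈S₂ =
  inj₂ (IsTiling-restrict (¬CommonEdgeMeet-sym ne)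
          (IsTiling-∪-comm {S₁ = S₁} {S₂} tiling) t₀∈S₂)

mainTheorem20 : {C : Set} (S₁ S₂ : PSet C) → ¬ CommonEdgeMeet S₁ S₂ →
    ((PeriodicSet S₁ × PeriodicSet S₂ → PeriodicSet (S₁ ∪ S₂)) ×
     (AperiodicSet S₁ × AperiodicSet S₂ → AperiodicSet (S₁ ∪ S₂)))
mainTheorem20 S₁ S₂ ne =
  (λ (per₁ , per₂) T tiling → [ per₁ T , per₂ T ] (IsTiling-∪-split ne tiling)) ,
  (λ (aper₁ , aper₂) T tiling → [ aper₁ T , aper₂ T ] (IsTiling-∪-split ne tiling))
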